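{- Let $\Gamma$ be a homomorphism homogeneous oriented graph. Then every induced oriented cycle in $\Gamma$ is isomorphic to $C_3$.
   Context: An oriented graph is a pair $\Gamma=(V,E)$ with $V$ a non-empty set and $E\subseteq V^2$ an asymmetric relation (no loops, at most one arc between two distinct vertices); write $x\to y$ for $(x,y)\in E$. An induced oriented cycle is an induced subgraph which is a directed cycle $x_1\to x_2\to\dots\to x_n\to x_1$ ($n\ge 3$) with no further arcs. $C_3$ denotes the directed cycle on three vertices. A homomorphism of oriented graphs is an arc-preserving map. $\Gamma$ is homomorphism homogeneous if every homomorphism between finite induced subgraphs of $\Gamma$ extends to an endomorphism of $\Gamma$. -}

module Defs where

open import Data.Nat using (ℕ; suc; _≤_)
open import Data.Fin using (Fin; toℕ)
open import Data.Product using (Σ; _×_)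
open import Data.Sum using (_⊎_)
open import Relation.Nullary using (¬_)
open import Relation.Binary.PropositionalEquality using (_≡_)
open import Function.Bundles using (_⇔_; _⤖_; Bijection)
open import Function.Definitions using (Injective)
open import Function.Base using (_∘_)

-- An oriented graph: non-empty vertex set, asymmetric arc relation
-- (asymmetry also excludes loops).
record OrientedGraph : Set₁ where
  field
    V    : Set
    _⇒_  : V → V → Set
    asym : ∀ {x y} → x ⇒ y → ¬ (y ⇒ x)
    v₀   : V

open OrientedGraph public

CycArc : (n : ℕ) → Fin n → Fin n → Set
CycArc n i j = (suc (toℕ i) ≡ toℕ j) ⊎ ((suc (toℕ i) ≡ n) × (toℕ j ≡ 0))

-- A finite induced subgraph of Γ is given by an injective enumeration
-- a : Fin n → V Γ of its vertex set; its arcs are those of Γ.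
-- A homomorphism between the finite induced subgraphs enumerated by a and b
-- is a map f : Fin n → Fin m preserving arcs.
-- Γ is homomorphism homogeneous if every such homomorphism extends to an
-- endomorphism of Γ.
HomHomogeneous : OrientedGraph → Set
HomHomogeneous Γ =
  (n m : ℕ) (a : Fin n → V Γ) (b : Fin m → V Γ) →
  Injective _≡_ _≡_ a → Injective _≡_ _≡_ b →
  (f : Fin n → Fin m) →
  (∀ i j → _⇒_ Γ (a i) (a j) → _⇒_ Γ (b (f i)) (b (f j))) →
  Σ (V Γ → V Γ) λ g →
    (∀ u v → _⇒_ Γ u v → _⇒_ Γ (g u) (g v)) × (∀ i → g (a i) ≡ b (f i))

InducedCycle : (Γ : OrientedGraph) (n : ℕ) → (Fin n → V Γ) → Set
InducedCycle Γ n x =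
  (3 ≤ n) × Injective _≡_ _≡_ x ×
  (∀ i j → (_⇒_ Γ (x i) (x j) ⇔ CycArc n i j))

InducedIsoC3 : (Γ : OrientedGraph) (n : ℕ) → (Fin n → V Γ) → Set
InducedIsoC3 Γ n x =
  Σ (Fin n ⤖ Fin 3) λ σ →
    ∀ i j → (_⇒_ Γ (x i) (x j) ⇔ CycArc 3 (Bijection.to σ i) (Bijection.to σ j))

{-# OPTIONS --safe #-}
-- Proof idea: if u → v → w with u and w non-adjacent, then {u, w} is an
-- independent pair, so collapsing it onto v is a homomorphism of finite induced
-- subgraphs.  Its extension g maps u → v → w to v → g v → v, contradicting
-- asymmetry.  An induced cycle of length at least 4 contains such a path
-- x₀ → x₁ → x₂, so only C₃ survives.
module Submission where

open import Defs
open import Data.Nat using (ℕ; zero; suc; _+_; s≤s)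
open import Data.Fin using (Fin; zero; suc)
open import Data.Vec.Functional using ([]; _∷_)
open import Data.Product using (Σ; _×_; _,_)
open import Data.Sum using (inj₁; inj₂)
open import Data.Empty using (⊥; ⊥-elim)
open import Relation.Nullary using (¬_)
open import Relation.Binary.PropositionalEquality using (_≡_; _≢_; refl; sym; subst)
open import Function.Bundles using (Equivalence)
open import Function.Definitions using (Injective)
open import Function.Construct.Identity using (⤖-id)

module _ (Γ : OrientedGraph) where

  private
    _⟶_ : V Γ → V Γ → Set
    _⟶_ = _⇒_ Γ

  variable
    u v w : V Γ

  pair-injective : u ≢ w → Injective _≡_ _≡_ (u ∷ w ∷ [])
  pair-injective u≢w {zero}     {zero}     _   = refl
  pair-injective u≢w {zero}     {suc zero} u≡w = ⊥-elim (u≢w u≡w)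
  pair-injective u≢w {suc zero} {zero}     w≡u = ⊥-elim (u≢w (sym w≡u))
  pair-injective u≢w {suc zero} {suc zero} _   = refl

  pair-independent : ¬ u ⟶ w → ¬ w ⟶ u → ∀ i j → ¬ (u ∷ w ∷ []) i ⟶ (u ∷ w ∷ []) j
  pair-independent ¬u⟶w ¬w⟶u zero       zero       u⟶u = asym Γ u⟶u u⟶u
  pair-independent ¬u⟶w ¬w⟶u zero       (suc zero) u⟶w = ¬u⟶w u⟶w
  pair-independent ¬u⟶w ¬w⟶u (suc zero) zero       w⟶u = ¬w⟶u w⟶u
  pair-independent ¬u⟶w ¬w⟶u (suc zero) (suc zero) w⟶w = asym Γ w⟶w w⟶w

  HomHomogeneous⇒collapse : HomHomogeneous Γ → u ≢ w → ¬ u ⟶ w → ¬ w ⟶ u →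
    ∀ v → Σ (V Γ → V Γ) λ g → (∀ p q → p ⟶ q → g p ⟶ g q) × g u ≡ v × g w ≡ v
  HomHomogeneous⇒collapse hh u≢w ¬u⟶w ¬w⟶u v
    with hh 2 1 (_ ∷ _ ∷ []) (λ _ → v) (pair-injective u≢w) (λ { {zero} {zero} _ → refl })
            (λ _ → zero) (λ i j i⟶j → ⊥-elim (pair-independent ¬u⟶w ¬w⟶u i j i⟶j))
  ... | g , g-hom , g-extends = g , g-hom , g-extends zero , g-extends (suc zero)

  HomHomogeneous⇒¬inducedPath₃ : HomHomogeneous Γ →
    u ⟶ v → v ⟶ w → ¬ u ⟶ w → ¬ w ⟶ u → ⊥
  HomHomogeneous⇒¬inducedPath₃ {u} {v} {w} hh u⟶v v⟶w ¬u⟶w ¬w⟶u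
    with HomHomogeneous⇒collapse hh (λ { refl → asym Γ u⟶v v⟶w }) ¬u⟶w ¬w⟶u v
  ... | g , g-hom , gu≡v , gw≡v = asym Γ v⟶gv gv⟶v
    where
    v⟶gv : v ⟶ g v
    v⟶gv = subst (_⟶ g v) gu≡v (g-hom u v u⟶v)
    gv⟶v : g v ⟶ v
    gv⟶v = subst (g v ⟶_) gw≡v (g-hom v w v⟶w)

  HomHomogeneous⇒inducedCycle-length≡3 : HomHomogeneous Γ →
    ∀ {n} {x : Fin n → V Γ} → InducedCycle Γ n x → n ≡ 3
  HomHomogeneous⇒inducedCycle-length≡3 hh {0} (() , _)
  HomHomogeneous⇒inducedCycle-length≡3 hh {1} (s≤s () , _)
  HomHomogeneous⇒inducedCycle-length≡3 hh {2} (s≤s (s≤s ()) , _)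
  HomHomogeneous⇒inducedCycle-length≡3 hh {3} _ = refl
  HomHomogeneous⇒inducedCycle-length≡3 hh {suc (suc (suc (suc k)))} (_ , _ , arcs) =
    ⊥-elim (HomHomogeneous⇒¬inducedPath₃ hh
      (Equivalence.from (arcs zero (suc zero)) (inj₁ refl))
      (Equivalence.from (arcs (suc zero) (suc (suc zero))) (inj₁ refl))
      (λ x₀⟶x₂ → ¬arc₀₂ (Equivalence.to (arcs zero (suc (suc zero))) x₀⟶x₂))
      (λ x₂⟶x₀ → ¬arc₂₀ (Equivalence.to (arcs (suc (suc zero)) zero) x₂⟶x₀)))
    where
    ¬arc₀₂ : ¬ CycArc (4 + k) zero (suc (suc zero))
    ¬arc₀₂ (inj₂ (() , _))
    ¬arc₂₀ : ¬ CycArc (4 + k) (suc (suc zero)) zero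
    ¬arc₂₀ (inj₂ (() , _))

lemma2p11 : (Γ : OrientedGraph) → HomHomogeneous Γ →
    (n : ℕ) (x : Fin n → V Γ) → InducedCycle Γ n x → InducedIsoC3 Γ n x
lemma2p11 Γ hh n x cycle@(_ , _ , arcs)
  with HomHomogeneous⇒inducedCycle-length≡3 Γ hh cycle
... | refl = ⤖-id (Fin 3) , arcs
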